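{- Let $(\mathcal L,\otimes,1)$ be the linear category of a non-trivial model of linear logic, with the symmetry of $\otimes$ denoted by $\gamma$. Then there exists an object $\Xi$ of $\mathcal L$ such that $\gamma_{\Xi,\Xi}\neq id_{\Xi\otimes\Xi}$.
   Context: A model of linear logic consists of a $\ast$-autonomous category $(\mathcal L,\otimes,1,\bot)$ with binary products and a terminal object (the linear category), a Cartesian category $(\mathcal M,\times,T)$, and a symmetric monoidal adjunction $(L,l,t)\dashv(M,m,u)$ with $L:\mathcal M\to\mathcal L$, $M:\mathcal L\to\mathcal M$; it induces the standard denotational interpretation $[\![\cdot]\!]$ of linear logic formulas as objects and proofs of $A$ as morphisms $1\to[\![A]\!]$ of $\mathcal L$, which is invariant under cut-elimination and compatible with the inference rules. The model is non-trivial if there exist a formula $A$ and two proofs $\pi,\pi'$ of $A$ with $[\![\pi]\!]\neq[\![\pi']\!]$. -}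

module Defs where

open import Level using (Level; _⊔_) renaming (suc to lsuc)
open import Relation.Binary using (Rel; IsEquivalence)
open import Relation.Nullary using (¬_)
open import Data.Nat using (ℕ)
open import Data.List using (List; []; _∷_; _++_; map)
open import Data.Product using (Σ; _,_)

record Category (o ℓ e : Level) : Set (lsuc (o ⊔ ℓ ⊔ e)) where
  infixr 9 _∘_
  infix 4 _≈_
  field
    Obj : Set o
    _⇒_ : Obj → Obj → Set ℓ
    _≈_ : ∀ {A B} → Rel (A ⇒ B) e
    id : ∀ {A} → A ⇒ A
    _∘_ : ∀ {A B C} → B ⇒ C → A ⇒ B → A ⇒ C
    equiv : ∀ {A B} → IsEquivalence (_≈_ {A} {B})
    ∘-resp-≈ : ∀ {A B C} {f h : B ⇒ C} {g i : A ⇒ B} → f ≈ h → g ≈ i → (f ∘ g) ≈ (h ∘ i)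
    assoc : ∀ {A B C D} {f : A ⇒ B} {g : B ⇒ C} {h : C ⇒ D} → ((h ∘ g) ∘ f) ≈ (h ∘ (g ∘ f))
    identityˡ : ∀ {A B} {f : A ⇒ B} → (id ∘ f) ≈ f
    identityʳ : ∀ {A B} {f : A ⇒ B} → (f ∘ id) ≈ f

record Functor {o ℓ e o′ ℓ′ e′ : Level} (C : Category o ℓ e) (D : Category o′ ℓ′ e′)
       : Set (o ⊔ ℓ ⊔ e ⊔ o′ ⊔ ℓ′ ⊔ e′) where
  private
    module C = Category C
    module D = Category D
  field
    F₀ : C.Obj → D.Obj
    F₁ : ∀ {A B} → A C.⇒ B → F₀ A D.⇒ F₀ B
    identity : ∀ {A} → F₁ (C.id {A}) D.≈ D.id
    homomorphism : ∀ {A B X} {f : A C.⇒ B} {g : B C.⇒ X} → F₁ (g C.∘ f) D.≈ (F₁ g D.∘ F₁ f)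
    F-resp-≈ : ∀ {A B} {f g : A C.⇒ B} → f C.≈ g → F₁ f D.≈ F₁ g

record MonoidalStr {o ℓ e : Level} (C : Category o ℓ e) : Set (o ⊔ ℓ) where
  open Category C
  infixr 10 _⊗₀_ _⊗₁_
  field
    _⊗₀_ : Obj → Obj → Obj
    _⊗₁_ : ∀ {A B X Y} → A ⇒ B → X ⇒ Y → (A ⊗₀ X) ⇒ (B ⊗₀ Y)
    𝟙 : Obj
    α⇒ : ∀ {A B X} → ((A ⊗₀ B) ⊗₀ X) ⇒ (A ⊗₀ (B ⊗₀ X))
    α⇐ : ∀ {A B X} → (A ⊗₀ (B ⊗₀ X)) ⇒ ((A ⊗₀ B) ⊗₀ X)
    unitˡ⇒ : ∀ {A} → (𝟙 ⊗₀ A) ⇒ A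
    unitˡ⇐ : ∀ {A} → A ⇒ (𝟙 ⊗₀ A)
    unitʳ⇒ : ∀ {A} → (A ⊗₀ 𝟙) ⇒ A
    unitʳ⇐ : ∀ {A} → A ⇒ (A ⊗₀ 𝟙)
    σ : ∀ {A B} → (A ⊗₀ B) ⇒ (B ⊗₀ A)

record IsSymmetricMonoidal {o ℓ e : Level} (C : Category o ℓ e) (S : MonoidalStr C)
       : Set (o ⊔ ℓ ⊔ e) where
  open Category C
  open MonoidalStr S
  field
    ⊗-identity : ∀ {A B} → (id {A} ⊗₁ id {B}) ≈ id
    ⊗-homomorphism : ∀ {A B X P Q Y} {f : A ⇒ B} {g : B ⇒ X} {h : P ⇒ Q} {k : Q ⇒ Y}
                     → ((g ∘ f) ⊗₁ (k ∘ h)) ≈ ((g ⊗₁ k) ∘ (f ⊗₁ h))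
    ⊗-resp-≈ : ∀ {A B X Y} {f g : A ⇒ B} {h k : X ⇒ Y} → f ≈ g → h ≈ k → (f ⊗₁ h) ≈ (g ⊗₁ k)
    α-isoˡ : ∀ {A B X} → (α⇐ ∘ α⇒ {A} {B} {X}) ≈ id
    α-isoʳ : ∀ {A B X} → (α⇒ ∘ α⇐ {A} {B} {X}) ≈ id
    unitˡ-isoˡ : ∀ {A} → (unitˡ⇐ ∘ unitˡ⇒ {A}) ≈ id
    unitˡ-isoʳ : ∀ {A} → (unitˡ⇒ ∘ unitˡ⇐ {A}) ≈ id
    unitʳ-isoˡ : ∀ {A} → (unitʳ⇐ ∘ unitʳ⇒ {A}) ≈ id
    unitʳ-isoʳ : ∀ {A} → (unitʳ⇒ ∘ unitʳ⇐ {A}) ≈ id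
    α-natural : ∀ {A B X P Q Y} {f : A ⇒ P} {g : B ⇒ Q} {h : X ⇒ Y}
                → (α⇒ ∘ ((f ⊗₁ g) ⊗₁ h)) ≈ ((f ⊗₁ (g ⊗₁ h)) ∘ α⇒)
    unitˡ-natural : ∀ {A B} {f : A ⇒ B} → (unitˡ⇒ ∘ (id ⊗₁ f)) ≈ (f ∘ unitˡ⇒)
    unitʳ-natural : ∀ {A B} {f : A ⇒ B} → (unitʳ⇒ ∘ (f ⊗₁ id)) ≈ (f ∘ unitʳ⇒)
    σ-natural : ∀ {A B X Y} {f : A ⇒ B} {g : X ⇒ Y} → (σ ∘ (f ⊗₁ g)) ≈ ((g ⊗₁ f) ∘ σ)
    pentagon : ∀ {A B X Y} →
      ((id {A} ⊗₁ α⇒ {B} {X} {Y}) ∘ (α⇒ ∘ (α⇒ ⊗₁ id))) ≈ (α⇒ ∘ α⇒)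
    triangle : ∀ {A B} → ((id {A} ⊗₁ unitˡ⇒ {B}) ∘ α⇒) ≈ (unitʳ⇒ ⊗₁ id)
    hexagon : ∀ {A B X} →
      (α⇒ {B} {X} {A} ∘ (σ ∘ α⇒)) ≈ ((id ⊗₁ σ) ∘ (α⇒ ∘ (σ ⊗₁ id)))
    σ-involutive : ∀ {A B} → (σ {B} {A} ∘ σ {A} {B}) ≈ id
    σ-unit : ∀ {A} → (unitˡ⇒ ∘ σ {A} {𝟙}) ≈ unitʳ⇒

-- Closed structure and *-autonomy (Barr: dualizing object ⊥)

record Closed {o ℓ e : Level} (C : Category o ℓ e) (S : MonoidalStr C) : Set (o ⊔ ℓ ⊔ e) where
  open Category C
  open MonoidalStr S
  infixr 5 _⊸_
  field
    _⊸_ : Obj → Obj → Obj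
    eval : ∀ {A B} → ((A ⊸ B) ⊗₀ A) ⇒ B
    curry : ∀ {A B X} → (X ⊗₀ A) ⇒ B → X ⇒ (A ⊸ B)
    curry-resp-≈ : ∀ {A B X} {f g : (X ⊗₀ A) ⇒ B} → f ≈ g → curry f ≈ curry g
    β : ∀ {A B X} {f : (X ⊗₀ A) ⇒ B} → (eval ∘ (curry f ⊗₁ id)) ≈ f
    η-unique : ∀ {A B X} {g : X ⇒ (A ⊸ B)} → curry (eval ∘ (g ⊗₁ id)) ≈ g

  double-dual : ∀ {A} (B : Obj) → A ⇒ ((A ⊸ B) ⊸ B)
  double-dual B = curry (eval ∘ σ)

record StarAutonomous {o ℓ e : Level} (C : Category o ℓ e) (S : MonoidalStr C)
       (K : Closed C S) : Set (o ⊔ ℓ ⊔ e) where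
  open Category C
  open Closed K
  field
    ⊥ : Obj
    double-dual⁻¹ : ∀ {A} → ((A ⊸ ⊥) ⊸ ⊥) ⇒ A
    dd-isoˡ : ∀ {A} → (double-dual⁻¹ ∘ double-dual {A} ⊥) ≈ id
    dd-isoʳ : ∀ {A} → (double-dual {A} ⊥ ∘ double-dual⁻¹) ≈ id

record Cartesian {o ℓ e : Level} (C : Category o ℓ e) : Set (o ⊔ ℓ ⊔ e) where
  open Category C
  infixr 7 _×_
  field
    ⊤ : Obj
    ! : ∀ {A} → A ⇒ ⊤
    !-unique : ∀ {A} (f : A ⇒ ⊤) → f ≈ !
    _×_ : Obj → Obj → Obj
    π₁ : ∀ {A B} → (A × B) ⇒ A
    π₂ : ∀ {A B} → (A × B) ⇒ B
    ⟨_,_⟩ : ∀ {A B X} → X ⇒ A → X ⇒ B → X ⇒ (A × B)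
    project₁ : ∀ {A B X} {f : X ⇒ A} {g : X ⇒ B} → (π₁ ∘ ⟨ f , g ⟩) ≈ f
    project₂ : ∀ {A B X} {f : X ⇒ A} {g : X ⇒ B} → (π₂ ∘ ⟨ f , g ⟩) ≈ g
    unique : ∀ {A B X} {h : X ⇒ (A × B)} {f : X ⇒ A} {g : X ⇒ B}
             → (π₁ ∘ h) ≈ f → (π₂ ∘ h) ≈ g → ⟨ f , g ⟩ ≈ h

  _×₁_ : ∀ {A B X Y} → A ⇒ B → X ⇒ Y → (A × X) ⇒ (B × Y)
  f ×₁ g = ⟨ f ∘ π₁ , g ∘ π₂ ⟩

cartesianStr : ∀ {o ℓ e} {C : Category o ℓ e} → Cartesian C → MonoidalStr C
cartesianStr {C = C} P = record
  { _⊗₀_ = _×_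
  ; _⊗₁_ = _×₁_
  ; 𝟙 = ⊤
  ; α⇒ = ⟨ π₁ ∘ π₁ , ⟨ π₂ ∘ π₁ , π₂ ⟩ ⟩
  ; α⇐ = ⟨ ⟨ π₁ , π₁ ∘ π₂ ⟩ , π₂ ∘ π₂ ⟩
  ; unitˡ⇒ = π₂
  ; unitˡ⇐ = ⟨ ! , id ⟩
  ; unitʳ⇒ = π₁
  ; unitʳ⇐ = ⟨ id , ! ⟩
  ; σ = ⟨ π₂ , π₁ ⟩
  }
  where open Category C
        open Cartesian P

record LaxSymMonoidalFunctor {o ℓ e o′ ℓ′ e′ : Level}
       {C : Category o ℓ e} {D : Category o′ ℓ′ e′}
       (SC : MonoidalStr C) (SD : MonoidalStr D) : Set (o ⊔ ℓ ⊔ e ⊔ o′ ⊔ ℓ′ ⊔ e′) where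
  private
    module C = Category C
    module D = Category D
    module SC = MonoidalStr SC
    module SD = MonoidalStr SD
  field
    F : Functor C D
  open Functor F public
  field
    φ : ∀ {A B} → (F₀ A SD.⊗₀ F₀ B) D.⇒ F₀ (A SC.⊗₀ B)
    φ₀ : SD.𝟙 D.⇒ F₀ SC.𝟙
    φ-natural : ∀ {A B X Y} {f : A C.⇒ B} {g : X C.⇒ Y}
                → (F₁ (f SC.⊗₁ g) D.∘ φ) D.≈ (φ D.∘ (F₁ f SD.⊗₁ F₁ g))
    associativity : ∀ {A B X} →
      (F₁ (SC.α⇒ {A} {B} {X}) D.∘ (φ D.∘ (φ SD.⊗₁ D.id)))
        D.≈ (φ D.∘ ((D.id SD.⊗₁ φ) D.∘ SD.α⇒))
    unitaryˡ : ∀ {A} → (F₁ (SC.unitˡ⇒ {A}) D.∘ (φ D.∘ (φ₀ SD.⊗₁ D.id))) D.≈ SD.unitˡ⇒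
    unitaryʳ : ∀ {A} → (F₁ (SC.unitʳ⇒ {A}) D.∘ (φ D.∘ (D.id SD.⊗₁ φ₀))) D.≈ SD.unitʳ⇒
    symmetry : ∀ {A B} → (F₁ (SC.σ {A} {B}) D.∘ φ) D.≈ (φ D.∘ SD.σ)

record Adjunction {o ℓ e o′ ℓ′ e′ : Level} {C : Category o ℓ e} {D : Category o′ ℓ′ e′}
       (F : Functor C D) (G : Functor D C) : Set (o ⊔ ℓ ⊔ e ⊔ o′ ⊔ ℓ′ ⊔ e′) where
  private
    module C = Category C
    module D = Category D
    module F = Functor F
    module G = Functor G
  field
    unit : ∀ {X} → X C.⇒ G.F₀ (F.F₀ X)
    counit : ∀ {A} → F.F₀ (G.F₀ A) D.⇒ A
    unit-natural : ∀ {X Y} {f : X C.⇒ Y} → (G.F₁ (F.F₁ f) C.∘ unit) C.≈ (unit C.∘ f)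
    counit-natural : ∀ {A B} {f : A D.⇒ B} → (counit D.∘ F.F₁ (G.F₁ f)) D.≈ (f D.∘ counit)
    zig : ∀ {X} → (counit D.∘ F.F₁ (unit {X})) D.≈ D.id
    zag : ∀ {A} → (G.F₁ (counit {A}) C.∘ unit) C.≈ C.id

record SymMonoidalAdjunction {o ℓ e o′ ℓ′ e′ : Level}
       {C : Category o ℓ e} {D : Category o′ ℓ′ e′}
       (SC : MonoidalStr C) (SD : MonoidalStr D) : Set (o ⊔ ℓ ⊔ e ⊔ o′ ⊔ ℓ′ ⊔ e′) where
  private
    module C = Category C
    module D = Category D
    module SC = MonoidalStr SC
    module SD = MonoidalStr SD
  field
    left : LaxSymMonoidalFunctor SC SD
    right : LaxSymMonoidalFunctor SD SC
    adjunction : Adjunction (LaxSymMonoidalFunctor.F left) (LaxSymMonoidalFunctor.F right)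
  private
    module Lf = LaxSymMonoidalFunctor left
    module Rf = LaxSymMonoidalFunctor right
  open Adjunction adjunction
  field
    -- unit and counit are monoidal natural transformations
    unit-⊗ : ∀ {X Y} → unit {X SC.⊗₀ Y} C.≈ (Rf.F₁ Lf.φ C.∘ (Rf.φ C.∘ (unit SC.⊗₁ unit)))
    unit-𝟙 : unit {SC.𝟙} C.≈ (Rf.F₁ Lf.φ₀ C.∘ Rf.φ₀)
    counit-⊗ : ∀ {A B} → (counit {A SD.⊗₀ B} D.∘ (Lf.F₁ Rf.φ D.∘ Lf.φ)) D.≈ (counit SD.⊗₁ counit)
    counit-𝟙 : (counit {SD.𝟙} D.∘ (Lf.F₁ Rf.φ₀ D.∘ Lf.φ₀)) D.≈ D.id

-- Models of linear logic (linear/non-linear adjunction)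

record LLModel (o ℓ e o′ ℓ′ e′ : Level) : Set (lsuc (o ⊔ ℓ ⊔ e ⊔ o′ ⊔ ℓ′ ⊔ e′)) where
  field
    𝓛 : Category o ℓ e
    ⊗-str : MonoidalStr 𝓛
    ⊗-sym : IsSymmetricMonoidal 𝓛 ⊗-str
    closed : Closed 𝓛 ⊗-str
    star : StarAutonomous 𝓛 ⊗-str closed
    𝓛-products : Cartesian 𝓛
    𝓜 : Category o′ ℓ′ e′
    𝓜-cartesian : Cartesian 𝓜
    adj : SymMonoidalAdjunction (cartesianStr 𝓜-cartesian) ⊗-str

  γ : ∀ {A B} → Category._⇒_ 𝓛 (MonoidalStr._⊗₀_ ⊗-str A B) (MonoidalStr._⊗₀_ ⊗-str B A)
  γ = MonoidalStr.σ ⊗-str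

infixr 30 _⊗_ _⅋_
infixr 25 _&_ _⊕_

data Formula : Set where
  atom atom⊥ : ℕ → Formula
  𝟏 ⊥ ⊤ 𝟎 : Formula
  _⊗_ _⅋_ _&_ _⊕_ : Formula → Formula → Formula
  !_ ⁇_ : Formula → Formula

_ᗮ : Formula → Formula
atom n ᗮ = atom⊥ n
atom⊥ n ᗮ = atom n
𝟏 ᗮ = ⊥
⊥ ᗮ = 𝟏
⊤ ᗮ = 𝟎
𝟎 ᗮ = ⊤
(A ⊗ B) ᗮ = (A ᗮ) ⅋ (B ᗮ)
(A ⅋ B) ᗮ = (A ᗮ) ⊗ (B ᗮ)
(A & B) ᗮ = (A ᗮ) ⊕ (B ᗮ)
(A ⊕ B) ᗮ = (A ᗮ) & (B ᗮ)
(! A) ᗮ = ⁇ (A ᗮ)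
(⁇ A) ᗮ = ! (A ᗮ)

infix 2 ⊢_
data ⊢_ : List Formula → Set where
  ax   : ∀ A → ⊢ A ∷ (A ᗮ) ∷ []
  cut  : ∀ {Γ Δ} A → ⊢ A ∷ Γ → ⊢ (A ᗮ) ∷ Δ → ⊢ Γ ++ Δ
  ex   : ∀ Γ {A B Δ} → ⊢ Γ ++ A ∷ B ∷ Δ → ⊢ Γ ++ B ∷ A ∷ Δ
  one  : ⊢ 𝟏 ∷ []
  bot  : ∀ {Γ} → ⊢ Γ → ⊢ ⊥ ∷ Γ
  tens : ∀ {A B Γ Δ} → ⊢ A ∷ Γ → ⊢ B ∷ Δ → ⊢ (A ⊗ B) ∷ Γ ++ Δ
  par  : ∀ {A B Γ} → ⊢ A ∷ B ∷ Γ → ⊢ (A ⅋ B) ∷ Γ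
  top  : ∀ {Γ} → ⊢ ⊤ ∷ Γ
  with' : ∀ {A B Γ} → ⊢ A ∷ Γ → ⊢ B ∷ Γ → ⊢ (A & B) ∷ Γ
  plus₁ : ∀ {A B Γ} → ⊢ A ∷ Γ → ⊢ (A ⊕ B) ∷ Γ
  plus₂ : ∀ {A B Γ} → ⊢ B ∷ Γ → ⊢ (A ⊕ B) ∷ Γ
  der  : ∀ {A Γ} → ⊢ A ∷ Γ → ⊢ (⁇ A) ∷ Γ
  weak : ∀ {A Γ} → ⊢ Γ → ⊢ (⁇ A) ∷ Γ
  contr : ∀ {A Γ} → ⊢ (⁇ A) ∷ (⁇ A) ∷ Γ → ⊢ (⁇ A) ∷ Γ
  prom : ∀ {A Γ} → ⊢ A ∷ map ⁇_ Γ → ⊢ (! A) ∷ map ⁇_ Γ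

module Interpretation {o ℓ e o′ ℓ′ e′ : Level} (𝔐 : LLModel o ℓ e o′ ℓ′ e′) where
  open LLModel 𝔐
  open Category 𝓛
  open MonoidalStr ⊗-str
  open Closed closed
  open StarAutonomous star renaming (⊥ to ⊥ₒ)
  open Cartesian 𝓛-products
  private
    module 𝓜 = Category 𝓜
    module MP = Cartesian 𝓜-cartesian
    module A = SymMonoidalAdjunction adj
    module Lf = LaxSymMonoidalFunctor A.left
    module Mf = LaxSymMonoidalFunctor A.right
    module Ad = Adjunction A.adjunction

  D : Obj → Obj
  D X = X ⊸ ⊥ₒ

  Dmap : ∀ {X Y} → X ⇒ Y → D Y ⇒ D X
  Dmap f = curry (eval ∘ (id ⊗₁ f))

  dd : ∀ {X} → X ⇒ D (D X)
  dd = double-dual ⊥ₒ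

  ddi : ∀ {X} → D (D X) ⇒ X
  ddi = double-dual⁻¹

  Bang : Obj → Obj
  Bang X = Lf.F₀ (Mf.F₀ X)

  bang₁ : ∀ {X Y} → X ⇒ Y → Bang X ⇒ Bang Y
  bang₁ f = Lf.F₁ (Mf.F₁ f)

  module _ (val : ℕ → Obj) where

    ⟦_⟧ : Formula → Obj
    ⟦ atom n ⟧ = val n
    ⟦ atom⊥ n ⟧ = D (val n)
    ⟦ 𝟏 ⟧ = 𝟙
    ⟦ ⊥ ⟧ = ⊥ₒ
    ⟦ ⊤ ⟧ = Cartesian.⊤ 𝓛-products
    ⟦ 𝟎 ⟧ = D (Cartesian.⊤ 𝓛-products)
    ⟦ A ⊗ B ⟧ = ⟦ A ⟧ ⊗₀ ⟦ B ⟧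
    ⟦ A ⅋ B ⟧ = D (D ⟦ A ⟧ ⊗₀ D ⟦ B ⟧)
    ⟦ A & B ⟧ = ⟦ A ⟧ × ⟦ B ⟧
    ⟦ A ⊕ B ⟧ = D (D ⟦ A ⟧ × D ⟦ B ⟧)
    ⟦ ! A ⟧ = Bang ⟦ A ⟧
    ⟦ ⁇ A ⟧ = D (Bang (D ⟦ A ⟧))

    negP : ∀ A → ⟦ A ᗮ ⟧ ⇒ D ⟦ A ⟧
    negN : ∀ A → D ⟦ A ⟧ ⇒ ⟦ A ᗮ ⟧
    kk : ∀ A → ⟦ A ⟧ ⇒ D ⟦ A ᗮ ⟧
    jj : ∀ A → D ⟦ A ᗮ ⟧ ⇒ ⟦ A ⟧
    kk A = Dmap (negP A) ∘ dd
    jj A = ddi ∘ Dmap (negN A)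

    negP (atom n) = id
    negP (atom⊥ n) = dd
    negP 𝟏 = curry unitʳ⇒
    negP ⊥ = curry unitˡ⇒
    negP ⊤ = id
    negP 𝟎 = dd
    negP (A ⊗ B) = Dmap (kk A ⊗₁ kk B)
    negP (A ⅋ B) = dd ∘ (negP A ⊗₁ negP B)
    negP (A & B) = Dmap (kk A ×₁ kk B)
    negP (A ⊕ B) = dd ∘ (negP A ×₁ negP B)
    negP (! A) = Dmap (bang₁ (kk A))
    negP (⁇ A) = dd ∘ bang₁ (negP A)

    negN (atom n) = id
    negN (atom⊥ n) = ddi
    negN 𝟏 = eval ∘ unitʳ⇐
    negN ⊥ = ddi ∘ Dmap (eval ∘ unitʳ⇐)
    negN ⊤ = id
    negN 𝟎 = ddi
    negN (A ⊗ B) = Dmap (jj A ⊗₁ jj B)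
    negN (A ⅋ B) = (negN A ⊗₁ negN B) ∘ ddi
    negN (A & B) = Dmap (jj A ×₁ jj B)
    negN (A ⊕ B) = (negN A ×₁ negN B) ∘ ddi
    negN (! A) = Dmap (bang₁ (jj A))
    negN (⁇ A) = bang₁ (negN A) ∘ ddi

    -- a sequent ⊢ A₁,…,Aₙ is interpreted by morphisms  D⟦A₁⟧ ⊗ (… ⊗ (D⟦Aₙ⟧ ⊗ 1)) → ⊥
    ⟦_⟧ᶜ : List Formula → Obj
    ⟦ [] ⟧ᶜ = 𝟙
    ⟦ A ∷ Γ ⟧ᶜ = D ⟦ A ⟧ ⊗₀ ⟦ Γ ⟧ᶜ

    split : ∀ Γ Δ → ⟦ Γ ++ Δ ⟧ᶜ ⇒ (⟦ Γ ⟧ᶜ ⊗₀ ⟦ Δ ⟧ᶜ)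
    split [] Δ = unitˡ⇐
    split (A ∷ Γ) Δ = α⇐ ∘ (id ⊗₁ split Γ Δ)

    swapAt : ∀ Γ {A B Δ} → ⟦ Γ ++ B ∷ A ∷ Δ ⟧ᶜ ⇒ ⟦ Γ ++ A ∷ B ∷ Δ ⟧ᶜ
    swapAt [] = α⇒ ∘ ((σ ⊗₁ id) ∘ α⇐)
    swapAt (C ∷ Γ) = id ⊗₁ swapAt Γ

    toR : ∀ {X Y} → (D Y ⊗₀ X) ⇒ ⊥ₒ → X ⇒ Y
    toR f = ddi ∘ curry (f ∘ σ)

    fromR : ∀ {X Y} → X ⇒ Y → (D Y ⊗₀ X) ⇒ ⊥ₒ
    fromR g = eval ∘ (id ⊗₁ g)

    weakMap : ∀ {X} → Bang X ⇒ 𝟙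
    weakMap = Ad.counit ∘ Lf.F₁ (Mf.φ₀ 𝓜.∘ MP.!)

    contrMap : ∀ {X} → Bang X ⇒ (Bang X ⊗₀ Bang X)
    contrMap = Ad.counit ∘ Lf.F₁ (Mf.φ 𝓜.∘ MP.⟨ Ad.unit , Ad.unit ⟩)

    Ξ : List Formula → 𝓜.Obj
    Ξ [] = MP.⊤
    Ξ (C ∷ Γ) = Mf.F₀ (D ⟦ C ⟧) MP.× Ξ Γ

    promL : ∀ Γ → ⟦ map ⁇_ Γ ⟧ᶜ ⇒ Lf.F₀ (Ξ Γ)
    promL [] = Lf.φ₀
    promL (C ∷ Γ) = Lf.φ ∘ (ddi ⊗₁ promL Γ)

    promM : ∀ Γ → Ξ Γ 𝓜.⇒ Mf.F₀ ⟦ map ⁇_ Γ ⟧ᶜ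
    promM [] = Mf.φ₀
    promM (C ∷ Γ) = Mf.φ 𝓜.∘ ((Mf.F₁ dd 𝓜.∘ Ad.unit) MP.×₁ promM Γ)

    ⟦_⟧ᵖ : ∀ {Γ} → ⊢ Γ → ⟦ Γ ⟧ᶜ ⇒ ⊥ₒ
    ⟦ ax A ⟧ᵖ = fromR (jj A ∘ unitʳ⇒)
    ⟦ cut {Γ} {Δ} A π π′ ⟧ᵖ =
      eval ∘ (σ ∘ ((toR ⟦ π ⟧ᵖ ⊗₁ (negP A ∘ toR ⟦ π′ ⟧ᵖ)) ∘ split Γ Δ))
    ⟦ ex Γ π ⟧ᵖ = ⟦ π ⟧ᵖ ∘ swapAt Γ
    ⟦ one ⟧ᵖ = fromR id
    ⟦ bot π ⟧ᵖ = fromR ⟦ π ⟧ᵖ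
    ⟦ tens {Γ = Γ} {Δ = Δ} π π′ ⟧ᵖ = fromR ((toR ⟦ π ⟧ᵖ ⊗₁ toR ⟦ π′ ⟧ᵖ) ∘ split Γ Δ)
    ⟦ par π ⟧ᵖ = ⟦ π ⟧ᵖ ∘ (α⇒ ∘ (ddi ⊗₁ id))
    ⟦ top ⟧ᵖ = fromR !
    ⟦ with' π π′ ⟧ᵖ = fromR ⟨ toR ⟦ π ⟧ᵖ , toR ⟦ π′ ⟧ᵖ ⟩
    ⟦ plus₁ π ⟧ᵖ = ⟦ π ⟧ᵖ ∘ ((π₁ ∘ ddi) ⊗₁ id)
    ⟦ plus₂ π ⟧ᵖ = ⟦ π ⟧ᵖ ∘ ((π₂ ∘ ddi) ⊗₁ id)
    ⟦ der π ⟧ᵖ = ⟦ π ⟧ᵖ ∘ ((Ad.counit ∘ ddi) ⊗₁ id)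
    ⟦ weak π ⟧ᵖ = ⟦ π ⟧ᵖ ∘ (unitˡ⇒ ∘ ((weakMap ∘ ddi) ⊗₁ id))
    ⟦ contr π ⟧ᵖ = ⟦ π ⟧ᵖ ∘ (α⇒ ∘ (((dd ⊗₁ dd) ∘ (contrMap ∘ ddi)) ⊗₁ id))
    ⟦ prom {A} {Γ} π ⟧ᵖ = fromR (Lf.F₁ (Mf.F₁ (toR ⟦ π ⟧ᵖ) 𝓜.∘ promM Γ) ∘ promL Γ)

    ⟦_⟧ₚ : ∀ {A} → ⊢ A ∷ [] → 𝟙 ⇒ ⟦ A ⟧
    ⟦ π ⟧ₚ = toR ⟦ π ⟧ᵖ

NonTrivial : ∀ {o ℓ e o′ ℓ′ e′} → LLModel o ℓ e o′ ℓ′ e′ → Set (o ⊔ e)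
NonTrivial 𝔐 =
  Σ (ℕ → Category.Obj (LLModel.𝓛 𝔐)) λ val →
  Σ Formula λ A →
  Σ (⊢ A ∷ []) λ π →
  Σ (⊢ A ∷ []) λ π′ →
  ¬ (Category._≈_ (LLModel.𝓛 𝔐) (Interpretation.⟦_⟧ₚ 𝔐 val π) (Interpretation.⟦_⟧ₚ 𝔐 val π′))

module Submission where

open import Defs
open import Level using (Level)
open import Data.Product using (Σ; _,_)
open import Relation.Nullary using (¬_)
open import Relation.Binary using (Setoid; IsEquivalence)
import Relation.Binary.Reasoning.Setoid as SetoidReasoning

-- If the symmetry is the identity on Ξ = X & 1, then swapping the points ⟨ f , id ⟩ and
-- ⟨ g , id ⟩ of Ξ and projecting gives f ⊗ id = (g ⊗ id) ∘ γ for all points f, g of X.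
-- Instantiating this also at g, g shows f ⊗ id = g ⊗ id (without needing the coherence
-- fact γ₁₁ = id), hence f = g: all points of X, in particular
-- the denotations of any two proofs of a formula, would coincide.

module HomSetoid {o ℓ e : Level} (C : Category o ℓ e) where
  open Category C

  hom-setoid : Obj → Obj → Setoid ℓ e
  hom-setoid A B = record { Carrier = A ⇒ B ; _≈_ = _≈_ ; isEquivalence = equiv }

  module _ {A B : Obj} where
    open IsEquivalence (equiv {A} {B}) public using (refl; sym; trans)
    open SetoidReasoning (hom-setoid A B) public

module SymmetricMonoidal {o ℓ e : Level} (C : Category o ℓ e) (S : MonoidalStr C)
                         (L : IsSymmetricMonoidal C S) where
  open Category C
  open MonoidalStr S
  open IsSymmetricMonoidal L
  open HomSetoid C

  ⊗-idʳ-injective : ∀ {A B} {f g : A ⇒ B} → (f ⊗₁ id {𝟙}) ≈ (g ⊗₁ id) → f ≈ g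
  ⊗-idʳ-injective {f = f} {g} f⊗id≈g⊗id = begin
    f                             ≈⟨ sym identityʳ ⟩
    f ∘ id                        ≈⟨ ∘-resp-≈ refl (sym unitʳ-isoʳ) ⟩
    f ∘ (unitʳ⇒ ∘ unitʳ⇐)         ≈⟨ sym assoc ⟩
    (f ∘ unitʳ⇒) ∘ unitʳ⇐         ≈⟨ ∘-resp-≈ (sym unitʳ-natural) refl ⟩
    (unitʳ⇒ ∘ (f ⊗₁ id)) ∘ unitʳ⇐ ≈⟨ ∘-resp-≈ (∘-resp-≈ refl f⊗id≈g⊗id) refl ⟩
    (unitʳ⇒ ∘ (g ⊗₁ id)) ∘ unitʳ⇐ ≈⟨ ∘-resp-≈ unitʳ-natural refl ⟩
    (g ∘ unitʳ⇒) ∘ unitʳ⇐         ≈⟨ assoc ⟩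
    g ∘ (unitʳ⇒ ∘ unitʳ⇐)         ≈⟨ ∘-resp-≈ refl unitʳ-isoʳ ⟩
    g ∘ id                        ≈⟨ identityʳ ⟩
    g                             ∎

  swap-points : ∀ {Y X Z} → σ {Y} {Y} ≈ id → (p : Y ⇒ X) (q : Y ⇒ Z) (a b : 𝟙 ⇒ Y) →
                ((p ∘ a) ⊗₁ (q ∘ b)) ≈ (((p ∘ b) ⊗₁ (q ∘ a)) ∘ σ)
  swap-points σ≈id p q a b = begin
    (p ∘ a) ⊗₁ (q ∘ b)         ≈⟨ ⊗-homomorphism ⟩
    (p ⊗₁ q) ∘ (a ⊗₁ b)        ≈⟨ ∘-resp-≈ refl (sym identityˡ) ⟩
    (p ⊗₁ q) ∘ (id ∘ (a ⊗₁ b)) ≈⟨ ∘-resp-≈ refl (∘-resp-≈ (sym σ≈id) refl) ⟩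
    (p ⊗₁ q) ∘ (σ ∘ (a ⊗₁ b))  ≈⟨ ∘-resp-≈ refl σ-natural ⟩
    (p ⊗₁ q) ∘ ((b ⊗₁ a) ∘ σ)  ≈⟨ sym assoc ⟩
    ((p ⊗₁ q) ∘ (b ⊗₁ a)) ∘ σ  ≈⟨ ∘-resp-≈ (sym ⊗-homomorphism) refl ⟩
    ((p ∘ b) ⊗₁ (q ∘ a)) ∘ σ   ∎

module SymmetricMonoidalWithProducts {o ℓ e : Level} (C : Category o ℓ e) (S : MonoidalStr C)
                                     (L : IsSymmetricMonoidal C S) (P : Cartesian C) where
  open Category C
  open MonoidalStr S
  open IsSymmetricMonoidal L using (⊗-resp-≈)
  open Cartesian P
  open HomSetoid C
  open SymmetricMonoidal C S L

  pointed : Obj → Obj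
  pointed X = X × 𝟙

  point⊗id≈point⊗id∘σ : ∀ {X} → σ {pointed X} {pointed X} ≈ id → (f g : 𝟙 ⇒ X) →
                        (f ⊗₁ id) ≈ ((g ⊗₁ id) ∘ σ)
  point⊗id≈point⊗id∘σ σ≈id f g = begin
    f ⊗₁ id                                    ≈⟨ ⊗-resp-≈ (sym project₁) (sym project₂) ⟩
    (π₁ ∘ ⟨ f , id ⟩) ⊗₁ (π₂ ∘ ⟨ g , id ⟩)       ≈⟨ swap-points σ≈id π₁ π₂ ⟨ f , id ⟩ ⟨ g , id ⟩ ⟩
    ((π₁ ∘ ⟨ g , id ⟩) ⊗₁ (π₂ ∘ ⟨ f , id ⟩)) ∘ σ ≈⟨ ∘-resp-≈ (⊗-resp-≈ project₁ project₂) refl ⟩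
    (g ⊗₁ id) ∘ σ                              ∎

  points-equal-if-σ-pointed≈id : ∀ {X} → σ {pointed X} {pointed X} ≈ id → (f g : 𝟙 ⇒ X) → f ≈ g
  points-equal-if-σ-pointed≈id σ≈id f g = ⊗-idʳ-injective (begin
    f ⊗₁ id       ≈⟨ point⊗id≈point⊗id∘σ σ≈id f g ⟩
    (g ⊗₁ id) ∘ σ ≈⟨ point⊗id≈point⊗id∘σ σ≈id g g ⟨
    g ⊗₁ id       ∎)

mainTheorem5 : ∀ {o ℓ e o′ ℓ′ e′ : Level} (𝔐 : LLModel o ℓ e o′ ℓ′ e′) → NonTrivial 𝔐 →
    Σ (Category.Obj (LLModel.𝓛 𝔐)) λ Ξ →
    ¬ (Category._≈_ (LLModel.𝓛 𝔐) (LLModel.γ 𝔐 {Ξ} {Ξ}) (Category.id (LLModel.𝓛 𝔐)))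
mainTheorem5 𝔐 (val , A , π , π′ , ⟦π⟧≉⟦π′⟧) =
  pointed ⟦A⟧ , λ γ≈id → ⟦π⟧≉⟦π′⟧ (points-equal-if-σ-pointed≈id γ≈id (⟦_⟧ₚ val π) (⟦_⟧ₚ val π′))
  where
  open LLModel 𝔐
  open SymmetricMonoidalWithProducts 𝓛 ⊗-str ⊗-sym 𝓛-products
  open Interpretation 𝔐 using (⟦_⟧; ⟦_⟧ₚ)
  ⟦A⟧ : Category.Obj 𝓛
  ⟦A⟧ = ⟦_⟧ val A
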